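{- Let $G=(V,E,w)$ be an edge-weighted graph with positive edge weights, $M^*$ a maximum weight matching, $\varepsilon\in(0,1]$, $T\ge1$ an integer, and $\lambda:=\frac{\varepsilon}{2T}$. Consider the following procedure: starting from a matching $M_0$, for $i=1,\dots,T$: each node colors itself black or white; let $\hat V_i$ be the set of nodes that are unmatched in $M_{i-1}$ or matched in $M_{i-1}$ by a bichromatic edge, let $H_i=(\hat V_i,\hat E_i)$ where $\hat E_i$ is the set of bichromatic edges of $G$ with both endpoints in $\hat V_i$; compute a $(1-\lambda)$-approximate maximum weight matching $N_i$ of $H_i$ and set $M_i:=N_i\cup\{e\in M_{i-1}: e\text{ monochromatic}\}$. Then if for some $i$ we have $w(M_i)\geq(1-\varepsilon/2)\cdot w(M^*)$, there is no iteration $j$ with $i<j\le T$ such that $w(M_j)<(1-\varepsilon)\cdot w(M^*)$.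
   Context: An edge is bichromatic if its endpoints have different colors, monochromatic otherwise. A $(1-\lambda)$-approximate maximum weight matching of $H_i$ is a matching of $H_i$ of weight at least $(1-\lambda)$ times the maximum weight of a matching of $H_i$ (edge weights inherited from $G$).
   Formalization: The edge weights and the parameter ε take rational values. -}

module Defs where

open import Data.Nat using (ℕ; zero; suc; _≤_; _<_)
open import Data.Fin using (Fin; zero; suc)
open import Data.Bool using (Bool; true; false; _∨_; _∧_; if_then_else_)
open import Data.Integer using (+_)
open import Data.Rational using (ℚ; 0ℚ; 1ℚ; _+_; _*_; _-_; _/_)
import Data.Rational as Q
open import Data.Product using (Σ; _×_; ∃)
open import Data.Sum using (_⊎_)
open import Data.Empty using (⊥)
open import Relation.Nullary using (¬_)
open import Relation.Binary.PropositionalEquality using (_≡_; _≢_)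

sumFin : (m : ℕ) → (Fin m → ℚ) → ℚ
sumFin zero    f = 0ℚ
sumFin (suc m) f = f zero + sumFin m (λ i → f (suc i))

record WGraph : Set where
  field
    n m   : ℕ
    src   : Fin m → Fin n
    tgt   : Fin m → Fin n
    w     : Fin m → ℚ
    loopless : ∀ e → src e ≢ tgt e
    simple   : ∀ e e' → (src e ≡ src e' × tgt e ≡ tgt e') ⊎ (src e ≡ tgt e' × tgt e ≡ src e') → e ≡ e'
    positive : ∀ e → 0ℚ Q.< w e
open WGraph public

EdgeSet : WGraph → Set
EdgeSet G = Fin (m G) → Bool

Incident : (G : WGraph) → Fin (n G) → Fin (m G) → Set
Incident G v e = (v ≡ src G e) ⊎ (v ≡ tgt G e)

IsMatching : (G : WGraph) → EdgeSet G → Set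
IsMatching G M = ∀ e e' → M e ≡ true → M e' ≡ true → e ≢ e' →
  ∀ v → Incident G v e → Incident G v e' → ⊥

weight : (G : WGraph) → EdgeSet G → ℚ
weight G M = sumFin (m G) (λ e → if M e then w G e else 0ℚ)

IsMaxWeightMatching : (G : WGraph) → EdgeSet G → Set
IsMaxWeightMatching G M = IsMatching G M × (∀ M' → IsMatching G M' → weight G M' Q.≤ weight G M)

Coloring : WGraph → Set
Coloring G = Fin (n G) → Bool

Bichromatic : (G : WGraph) → Coloring G → Fin (m G) → Set
Bichromatic G c e = c (src G e) ≢ c (tgt G e)

isMono : (G : WGraph) → Coloring G → Fin (m G) → Bool
isMono G c e = if c (src G e) then c (tgt G e) else Data.Bool.not (c (tgt G e))
  where import Data.Bool

InVhat : (G : WGraph) → Coloring G → EdgeSet G → Fin (n G) → Set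
InVhat G c M v =
  (∀ e → M e ≡ true → ¬ Incident G v e)
  ⊎ (Σ (Fin (m G)) λ e → M e ≡ true × Incident G v e × Bichromatic G c e)

InHatE : (G : WGraph) → Coloring G → EdgeSet G → Fin (m G) → Set
InHatE G c M e = Bichromatic G c e × InVhat G c M (src G e) × InVhat G c M (tgt G e)

IsMatchingH : (G : WGraph) → Coloring G → EdgeSet G → EdgeSet G → Set
IsMatchingH G c M N = IsMatching G N × (∀ e → N e ≡ true → InHatE G c M e)

IsApproxMWM : (G : WGraph) → Coloring G → EdgeSet G → ℚ → EdgeSet G → Set
IsApproxMWM G c M lam N = IsMatchingH G c M N ×
  (∀ N' → IsMatchingH G c M N' → (1ℚ - lam) * weight G N' Q.≤ weight G N)

-- λ = ε / (2T)  (T ≥ 1; the value for T = 0 is irrelevant)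
lamOf : ℚ → ℕ → ℚ
lamOf ε zero    = 0ℚ
lamOf ε (suc t) = ε * ((+ 1) / (2 Data.Nat.* suc t))
  where import Data.Nat

IsRun : (G : WGraph) → ℚ → ℕ → (ℕ → EdgeSet G) → (ℕ → Coloring G) → (ℕ → EdgeSet G) → Set
IsRun G ε T M col N =
  IsMatching G (M 0) ×
  (∀ i → 1 ≤ i → i ≤ T →
     IsApproxMWM G (col i) (M (Data.Nat.pred i)) (lamOf ε T) (N i) ×
     (∀ e → M i e ≡ (N i e ∨ (M (Data.Nat.pred i) e ∧ isMono G (col i) e))))
  where import Data.Nat

{-# OPTIONS --safe #-}
-- One iteration loses at most λ·w(M*). The matched edges of M_{i-1} split into
-- monochromatic ones, which survive into M_i, and bichromatic ones, which form a
-- matching B of H_i; hence w(N_i) ≥ (1-λ)·w(B) ≥ w(B) - λ·w(M*), and N_i does not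
-- collide with the surviving edges because its endpoints lie in V̂_i. Over the at
-- most T iterations from i to j the total loss is at most T·λ·w(M*) = (ε/2)·w(M*),
-- so w(M_j) ≥ (1 - ε/2)·w(M*) - (ε/2)·w(M*) = (1 - ε)·w(M*).
module Submission where

open import Defs
open import Data.Nat using (ℕ; zero; suc; z≤n; s≤s; _<_)
import Data.Nat as N
import Data.Nat.Properties as NP
open import Data.Nat.Tactic.RingSolver renaming (solve to ℕ-solve) using ()
open import Data.Integer using (+_)
import Data.Integer as ℤ
open import Data.Integer.Tactic.RingSolver using (solve-∀)
open import Data.Rational using (ℚ; 0ℚ; 1ℚ; ½; _+_; _*_; _-_; _/_; _≤_; toℚᵘ; fromℚᵘ)
import Data.Rational as Q
import Data.Rational.Properties as QP
open import Data.Rational.Solver using (module +-*-Solver)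
open import Data.Rational.Unnormalised using (mkℚᵘ; *≡*) renaming (_≃_ to _≃ᵘ_)
import Data.Rational.Unnormalised as ℚᵘ
import Data.Rational.Unnormalised.Properties as UP
open import Data.Bool using (true; false; _∨_; _∧_; not; if_then_else_)
open import Data.Bool.Properties using (∧-conicalˡ; ∧-conicalʳ; ∧-zeroʳ; not-injective)
open import Data.Fin using (Fin; zero; suc)
open import Data.List using (_∷_; [])
open import Data.Product using (_,_; proj₁; proj₂)
open import Data.Sum using (_⊎_; inj₁; inj₂)
open import Data.Empty using (⊥; ⊥-elim)
open import Function using (_∘_)
open import Relation.Nullary using (¬_)
open import Relation.Binary.PropositionalEquality
open import Algebra.Bundles using (Ring; CommutativeMonoid)
open import Algebra.Properties.Semiring.Mult (Ring.semiring QP.+-*-ring)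
  using (_×_; ×-assoc-*; ×-comm-*)
open import Algebra.Properties.CommutativeSemigroup
  (CommutativeMonoid.commutativeSemigroup QP.+-0-commutativeMonoid) using (interchange)

∨≡true⇒ : ∀ a b → a ∨ b ≡ true → a ≡ true ⊎ b ≡ true
∨≡true⇒ true  b _   = inj₁ refl
∨≡true⇒ false b b≡t = inj₂ b≡t

≡∧not∨∧ : ∀ a b → a ≡ (a ∧ not b) ∨ (a ∧ b)
≡∧not∨∧ true  true  = refl
≡∧not∨∧ true  false = refl
≡∧not∨∧ false b     = refl

∧not≡true⇒∧≡false : ∀ a b → a ∧ not b ≡ true → a ∧ b ≡ false
∧not≡true⇒∧≡false true  false _ = refl
∧not≡true⇒∧≡false false b     _ = refl

sumFin-cong : ∀ m {f g : Fin m → ℚ} → (∀ i → f i ≡ g i) → sumFin m f ≡ sumFin m g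
sumFin-cong zero    f≗g = refl
sumFin-cong (suc m) f≗g = cong₂ _+_ (f≗g zero) (sumFin-cong m (f≗g ∘ suc))

sumFin-+ : ∀ m (f g : Fin m → ℚ) →
  sumFin m (λ i → f i + g i) ≡ sumFin m f + sumFin m g
sumFin-+ zero    f g = sym (QP.+-identityˡ 0ℚ)
sumFin-+ (suc m) f g = trans
  (cong (λ s → (f zero + g zero) + s) (sumFin-+ m (f ∘ suc) (g ∘ suc)))
  (interchange (f zero) (g zero) _ _)

sumFin-nonNeg : ∀ m {f : Fin m → ℚ} → (∀ i → 0ℚ ≤ f i) → 0ℚ ≤ sumFin m f
sumFin-nonNeg zero    f≥0 = QP.≤-refl
sumFin-nonNeg (suc m) f≥0 = QP.+-mono-≤ (f≥0 zero) (sumFin-nonNeg m (f≥0 ∘ suc))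

×-nonNeg : ∀ n {x} → 0ℚ ≤ x → 0ℚ ≤ n × x
×-nonNeg zero    x≥0 = QP.≤-refl
×-nonNeg (suc n) x≥0 = QP.+-mono-≤ x≥0 (×-nonNeg n x≥0)

×-monoˡ-≤-nonNeg : ∀ {m n x} → m N.≤ n → 0ℚ ≤ x → m × x ≤ n × x
×-monoˡ-≤-nonNeg {n = n} z≤n       x≥0 = ×-nonNeg n x≥0
×-monoˡ-≤-nonNeg {x = x} (s≤s m≤n) x≥0 = QP.+-monoʳ-≤ x (×-monoˡ-≤-nonNeg m≤n x≥0)

toℚᵘ-×-1ℚ : ∀ n → toℚᵘ (n × 1ℚ) ≃ᵘ mkℚᵘ (+ n) 0
toℚᵘ-×-1ℚ zero    = UP.≃-refl
toℚᵘ-×-1ℚ (suc n) = UP.≃-trans (QP.toℚᵘ-homo-+ 1ℚ (n × 1ℚ))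
  (UP.≃-trans (UP.+-congʳ (toℚᵘ 1ℚ) (toℚᵘ-×-1ℚ n)) (*≡* (1+x/1≃[1+x]/1 (+ n))))
  where
  1+x/1≃[1+x]/1 : ∀ x → (+ 1 ℤ.* + 1 ℤ.+ x ℤ.* + 1) ℤ.* + 1 ≡ (+ 1 ℤ.+ x) ℤ.* + 1
  1+x/1≃[1+x]/1 = solve-∀

×-1/2n : ∀ t → suc t × (+ 1 / (2 N.* suc t)) ≡ ½
×-1/2n t = QP.toℚᵘ-injective (begin
  toℚᵘ (suc t × u)              ≡⟨ cong toℚᵘ (sym (trans (×-assoc-* (suc t) 1ℚ u)
                                                         (cong (suc t ×_) (QP.*-identityˡ u)))) ⟩
  toℚᵘ ((suc t × 1ℚ) * u)       ≈⟨ QP.toℚᵘ-homo-* (suc t × 1ℚ) u ⟩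
  toℚᵘ (suc t × 1ℚ) ℚᵘ.* toℚᵘ u ≈⟨ UP.*-cong (toℚᵘ-×-1ℚ (suc t)) (QP.toℚᵘ-fromℚᵘ u′) ⟩
  mkℚᵘ (+ suc t) 0 ℚᵘ.* u′      ≈⟨ *≡* (cong (+_) (ℕ-solve (t ∷ []))) ⟩
  toℚᵘ ½                        ∎)
  where
  open UP.≃-Reasoning
  u′ : ℚᵘ.ℚᵘ
  u′ = mkℚᵘ (+ 1) (t N.+ suc (t N.+ 0))
  -- u unfolds definitionally to + 1 / (2 N.* suc t).
  u : ℚ
  u = fromℚᵘ u′

lamOf-nonNeg : ∀ {ε} → 0ℚ ≤ ε → ∀ T → 0ℚ ≤ lamOf ε T
lamOf-nonNeg     ε≥0 zero    = QP.≤-refl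
lamOf-nonNeg {ε} ε≥0 (suc t) = QP.nonNegative⁻¹ _
  {{QP.nonNeg*nonNeg⇒nonNeg ε {{Q.nonNegative ε≥0}} _ {{QP.normalize-nonNeg 1 (2 N.* suc t)}}}}

×-lamOf : ∀ ε t → suc t × lamOf ε (suc t) ≡ ½ * ε
×-lamOf ε t = begin
  suc t × (ε * u)  ≡⟨ sym (×-comm-* (suc t) ε u) ⟩
  ε * (suc t × u)  ≡⟨ cong (ε *_) (×-1/2n t) ⟩
  ε * ½            ≡⟨ QP.*-comm ε ½ ⟩
  ½ * ε            ∎
  where
  open ≡-Reasoning
  u = + 1 / (2 N.* suc t)

total-drop-after : ∀ (a : ℕ → ℚ) (x : ℚ) {T} → (∀ k → k < T → a k ≤ a (suc k) + x) →
  ∀ i d → i N.+ d N.≤ T → a i ≤ a (i N.+ d) + d × x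
total-drop-after a x step i zero    _ rewrite NP.+-identityʳ i =
  QP.≤-reflexive (sym (QP.+-identityʳ (a i)))
total-drop-after a x step i (suc d) i+d<T rewrite NP.+-suc i d = begin
  a i                               ≤⟨ total-drop-after a x step i d (NP.<⇒≤ i+d<T) ⟩
  a (i N.+ d) + d × x               ≤⟨ QP.+-monoˡ-≤ (d × x) (step (i N.+ d) i+d<T) ⟩
  a (suc (i N.+ d)) + x + d × x     ≡⟨ QP.+-assoc (a (suc (i N.+ d))) x (d × x) ⟩
  a (suc (i N.+ d)) + suc d × x     ∎
  where open QP.≤-Reasoning

total-drop-bounded : ∀ (a : ℕ → ℚ) {x} {T} → 0ℚ ≤ x → (∀ k → k < T → a k ≤ a (suc k) + x) →
  ∀ {i j} → i N.≤ j → j N.≤ T → a i ≤ a j + T × x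
total-drop-bounded a {x} x≥0 step {i} i≤j j≤T with NP.m≤n⇒∃[o]m+o≡n i≤j
... | d , refl = QP.≤-trans (total-drop-after a x step i d j≤T)
  (QP.+-monoʳ-≤ (a (i N.+ d)) (×-monoˡ-≤-nonNeg (NP.≤-trans (NP.m≤n+m d i) j≤T) x≥0))

module _ (G : WGraph) where

  VertexDisjoint : EdgeSet G → EdgeSet G → Set
  VertexDisjoint A B = ∀ a b → A a ≡ true → B b ≡ true →
    ∀ v → Incident G v a → Incident G v b → ⊥

  IsMatching-⊆ : ∀ {A B} → (∀ e → B e ≡ true → A e ≡ true) → IsMatching G A → IsMatching G B
  IsMatching-⊆ B⊆A matchA e e′ Be Be′ = matchA e e′ (B⊆A e Be) (B⊆A e′ Be′)

  IsMatching-∨ : ∀ {A B C} → IsMatching G A → IsMatching G B → VertexDisjoint A B →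
    (∀ e → C e ≡ A e ∨ B e) → IsMatching G C
  IsMatching-∨ {A} matchA matchB A#B C≗A∨B e e′ Ce Ce′ e≢e′ v v∈e v∈e′
    with ∨≡true⇒ (A e) _ (trans (sym (C≗A∨B e)) Ce) | ∨≡true⇒ (A e′) _ (trans (sym (C≗A∨B e′)) Ce′)
  ... | inj₁ Ae | inj₁ Ae′ = matchA e e′ Ae Ae′ e≢e′ v v∈e v∈e′
  ... | inj₁ Ae | inj₂ Be′ = A#B e e′ Ae Be′ v v∈e v∈e′
  ... | inj₂ Be | inj₁ Ae′ = A#B e′ e Ae′ Be v v∈e′ v∈e
  ... | inj₂ Be | inj₂ Be′ = matchB e e′ Be Be′ e≢e′ v v∈e v∈e′

  weight-cong : ∀ {A B} → (∀ e → A e ≡ B e) → weight G A ≡ weight G B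
  weight-cong A≗B = sumFin-cong (m G) (λ e → cong (λ b → if b then w G e else 0ℚ) (A≗B e))

  weight-nonNeg : ∀ A → 0ℚ ≤ weight G A
  weight-nonNeg A = sumFin-nonNeg (m G) edge-nonNeg
    where
    edge-nonNeg : ∀ e → 0ℚ ≤ (if A e then w G e else 0ℚ)
    edge-nonNeg e with A e
    ... | true  = QP.<⇒≤ (positive G e)
    ... | false = QP.≤-refl

  weight-∨ : ∀ A B → (∀ e → A e ≡ true → B e ≡ false) →
    weight G (λ e → A e ∨ B e) ≡ weight G A + weight G B
  weight-∨ A B A∩B≡∅ = trans (sumFin-cong (m G) edge-∨) (sumFin-+ (m G) _ _)
    where
    edge-∨ : ∀ e → (if A e ∨ B e then w G e else 0ℚ) ≡
                   (if A e then w G e else 0ℚ) + (if B e then w G e else 0ℚ)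
    edge-∨ e with A e in Ae
    ... | false = sym (QP.+-identityˡ _)
    ... | true rewrite A∩B≡∅ e Ae = sym (QP.+-identityʳ (w G e))

module _ (G : WGraph) (c : Coloring G) where

  monochromaticPart bichromaticPart : EdgeSet G → EdgeSet G
  monochromaticPart M e = M e ∧ isMono G c e
  bichromaticPart   M e = M e ∧ not (isMono G c e)

  isMono≡true⇒monochromatic : ∀ e → isMono G c e ≡ true → c (src G e) ≡ c (tgt G e)
  isMono≡true⇒monochromatic e mono with c (src G e) | c (tgt G e)
  ... | true  | true  = refl
  ... | false | false = refl
  isMono≡true⇒monochromatic e () | true  | false
  isMono≡true⇒monochromatic e () | false | true

  isMono≡false⇒bichromatic : ∀ e → isMono G c e ≡ false → Bichromatic G c e
  isMono≡false⇒bichromatic e notMono mono with c (src G e) | c (tgt G e)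
  isMono≡false⇒bichromatic e () _ | true  | true
  isMono≡false⇒bichromatic e () _ | false | false
  isMono≡false⇒bichromatic e _ () | true  | false
  isMono≡false⇒bichromatic e _ () | false | true

  bichromatic⇒isMono≡false : ∀ e → Bichromatic G c e → isMono G c e ≡ false
  bichromatic⇒isMono≡false e bi with isMono G c e in mono
  ... | false = refl
  ... | true  = ⊥-elim (bi (isMono≡true⇒monochromatic e mono))

  weight-by-colour : ∀ M → weight G M ≡ weight G (bichromaticPart M) + weight G (monochromaticPart M)
  weight-by-colour M = trans (weight-cong G (λ e → ≡∧not∨∧ (M e) (isMono G c e)))
    (weight-∨ G (bichromaticPart M) (monochromaticPart M)
      (λ e → ∧not≡true⇒∧≡false (M e) (isMono G c e)))

  bichromaticPart-isMatchingH : ∀ {M} → IsMatching G M → IsMatchingH G c M (bichromaticPart M)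
  bichromaticPart-isMatchingH {M} matchM =
    IsMatching-⊆ G (λ e → ∧-conicalˡ (M e) _) matchM , inHatE
    where
    inHatE : ∀ e → bichromaticPart M e ≡ true → InHatE G c M e
    inHatE e Be = bi , inj₂ (e , Me , inj₁ refl , bi) , inj₂ (e , Me , inj₂ refl , bi)
      where
      Me : M e ≡ true
      Me = ∧-conicalˡ (M e) _ Be
      bi : Bichromatic G c e
      bi = isMono≡false⇒bichromatic e (not-injective (∧-conicalʳ (M e) _ Be))

  matchingH-endpoint∈V̂ : ∀ {M N e v} → IsMatchingH G c M N → N e ≡ true →
    Incident G v e → InVhat G c M v
  matchingH-endpoint∈V̂ (_ , N⊆Ê) Ne (inj₁ refl) = proj₁ (proj₂ (N⊆Ê _ Ne))
  matchingH-endpoint∈V̂ (_ , N⊆Ê) Ne (inj₂ refl) = proj₂ (proj₂ (N⊆Ê _ Ne))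

  matchingH-avoids-monochromaticPart : ∀ {M N} → IsMatching G M → IsMatchingH G c M N →
    VertexDisjoint G N (monochromaticPart M)
  matchingH-avoids-monochromaticPart {M} matchM matchN e f Ne Mono-f v v∈e v∈f
    with matchingH-endpoint∈V̂ matchN Ne v∈e
  ... | inj₁ unmatched = unmatched f (∧-conicalˡ (M f) _ Mono-f) v∈f
  ... | inj₂ (g , Mg , v∈g , bi-g) = matchM g f Mg (∧-conicalˡ (M f) _ Mono-f) g≢f v v∈g v∈f
    where
    g≢f : g ≢ f
    g≢f refl = bi-g (isMono≡true⇒monochromatic g (∧-conicalʳ (M g) _ Mono-f))

  IsIteration : EdgeSet G → EdgeSet G → EdgeSet G → Set
  IsIteration M N M′ = ∀ e → M′ e ≡ N e ∨ monochromaticPart M e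

  iteration-isMatching : ∀ {M N M′} → IsMatching G M → IsMatchingH G c M N →
    IsIteration M N M′ → IsMatching G M′
  iteration-isMatching {M} matchM matchN =
    IsMatching-∨ G (proj₁ matchN) (IsMatching-⊆ G (λ e → ∧-conicalˡ (M e) _) matchM)
      (matchingH-avoids-monochromaticPart matchM matchN)

  iteration-weight : ∀ {M N M′ lam W} → 0ℚ ≤ lam → (∀ B → IsMatching G B → weight G B ≤ W) →
    IsMatching G M → IsApproxMWM G c M lam N → IsIteration M N M′ →
    weight G M ≤ weight G M′ + lam * W
  iteration-weight {M} {N} {M′} {lam} {W} lam≥0 bound matchM (matchN , approx) M′≗ = begin
    weight G M                                 ≡⟨ weight-by-colour M ⟩
    wB + wMono                                 ≡⟨ split-off-lam lam wB wMono ⟩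
    ((1ℚ - lam) * wB + lam * wB) + wMono       ≤⟨ QP.+-monoˡ-≤ wMono (QP.+-mono-≤ (approx B matchB)
                                                    (QP.*-monoˡ-≤-nonNeg lam {{Q.nonNegative lam≥0}}
                                                      (bound B (proj₁ matchB)))) ⟩
    (weight G N + lam * W) + wMono             ≡⟨ swap-last (weight G N) (lam * W) wMono ⟩
    (weight G N + wMono) + lam * W             ≡⟨ cong (_+ lam * W) (sym weight-M′) ⟩
    weight G M′ + lam * W                      ∎
    where
    open QP.≤-Reasoning
    open +-*-Solver
    B : EdgeSet G
    B = bichromaticPart M
    wB wMono : ℚ
    wB    = weight G B
    wMono = weight G (monochromaticPart M)
    matchB : IsMatchingH G c M B
    matchB = bichromaticPart-isMatchingH matchM

    N∩Mono≡∅ : ∀ e → N e ≡ true → monochromaticPart M e ≡ false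
    N∩Mono≡∅ e Ne rewrite bichromatic⇒isMono≡false e (proj₁ (proj₂ matchN e Ne)) = ∧-zeroʳ (M e)

    weight-M′ : weight G M′ ≡ weight G N + wMono
    weight-M′ = trans (weight-cong G M′≗) (weight-∨ G N (monochromaticPart M) N∩Mono≡∅)

    split-off-lam : ∀ l b o → b + o ≡ ((1ℚ - l) * b + l * b) + o
    split-off-lam = solve 3 (λ l b o → b :+ o := ((con 1ℚ :- l) :* b :+ l :* b) :+ o) refl
    swap-last : ∀ a b o → (a + b) + o ≡ (a + o) + b
    swap-last = solve 3 (λ a b o → (a :+ b) :+ o := (a :+ o) :+ b) refl

module _ (G : WGraph) (ε : ℚ) (T : ℕ)
  (M : ℕ → EdgeSet G) (col : ℕ → Coloring G) (Nm : ℕ → EdgeSet G) (run : IsRun G ε T M col Nm) where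

  run-isMatching : ∀ k → k N.≤ T → IsMatching G (M k)
  run-isMatching zero    _   = proj₁ run
  run-isMatching (suc k) k<T = iteration-isMatching G (col (suc k))
    (run-isMatching k (NP.<⇒≤ k<T)) (proj₁ (proj₁ iteration)) (proj₂ iteration)
    where iteration = proj₂ run (suc k) (s≤s z≤n) k<T

  run-weight-drop : ∀ {W} → 0ℚ ≤ lamOf ε T → (∀ B → IsMatching G B → weight G B ≤ W) →
    ∀ k → k < T → weight G (M k) ≤ weight G (M (suc k)) + lamOf ε T * W
  run-weight-drop lam≥0 bound k k<T = iteration-weight G (col (suc k)) lam≥0 bound
    (run-isMatching k (NP.<⇒≤ k<T)) (proj₁ iteration) (proj₂ iteration)
    where iteration = proj₂ run (suc k) (s≤s z≤n) k<T

lemma5p5 : (G : WGraph) (Mstar : EdgeSet G) → IsMaxWeightMatching G Mstar →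
    (ε : ℚ) → 0ℚ Q.< ε → ε ≤ 1ℚ → (T : ℕ) → 1 N.≤ T →
    (M : ℕ → EdgeSet G) (col : ℕ → Coloring G) (Nm : ℕ → EdgeSet G) →
    IsRun G ε T M col Nm →
    ∀ i → i N.≤ T → (1ℚ - ½ * ε) * weight G Mstar ≤ weight G (M i) →
    ∀ j → i < j → j N.≤ T → ¬ (weight G (M j) Q.< (1ℚ - ε) * weight G Mstar)
lemma5p5 G Mstar (_ , maximum) ε ε>0 _ T@(suc t) (s≤s z≤n) M col Nm run i _ M-i-good j i<j j≤T M-j-bad =
  QP.<-irrefl refl (begin-strict
    (1ℚ - ½ * ε) * W                   ≤⟨ M-i-good ⟩
    weight G (M i)                     ≤⟨ total-drop-bounded (weight G ∘ M) loss≥0 step-loss (NP.<⇒≤ i<j) j≤T ⟩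
    weight G (M j) + T × (lam * W)     ≡⟨ cong (λ loss → weight G (M j) + loss) total-loss ⟩
    weight G (M j) + (½ * ε) * W       <⟨ QP.+-monoˡ-< ((½ * ε) * W) M-j-bad ⟩
    (1ℚ - ε) * W + (½ * ε) * W         ≡⟨ halves ε W ⟩
    (1ℚ - ½ * ε) * W                   ∎)
  where
  open QP.≤-Reasoning
  open +-*-Solver
  W lam : ℚ
  W   = weight G Mstar
  lam = lamOf ε T
  lam≥0 : 0ℚ ≤ lam
  lam≥0 = lamOf-nonNeg (QP.<⇒≤ ε>0) T
  step-loss : ∀ k → k < T → weight G (M k) ≤ weight G (M (suc k)) + lam * W
  step-loss = run-weight-drop G ε T M col Nm run lam≥0 maximum
  loss≥0 : 0ℚ ≤ lam * W
  loss≥0 = QP.nonNegative⁻¹ (lam * W)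
    {{QP.nonNeg*nonNeg⇒nonNeg lam {{Q.nonNegative lam≥0}} W {{Q.nonNegative (weight-nonNeg G Mstar)}}}}
  total-loss : T × (lam * W) ≡ (½ * ε) * W
  total-loss = trans (sym (×-assoc-* T lam W)) (cong (_* W) (×-lamOf ε t))
  halves : ∀ e w → (1ℚ - e) * w + (½ * e) * w ≡ (1ℚ - ½ * e) * w
  halves = solve 2 (λ e w → (con 1ℚ :- e) :* w :+ (con ½ :* e) :* w := (con 1ℚ :- con ½ :* e) :* w) refl
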